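{- Let $G$ be a planar connected (undirected) graph without cut vertices, and assume $G$ has $C$ faces. Then one can subdivide at most $C$ edges of $G$ to obtain a graph without odd cycles.
   Context: Subdividing an edge $uv$ means replacing it by a new vertex $w$ and the edges $uw$, $wv$. -}

module Defs where

open import Data.Nat using (ℕ; zero; suc; _+_; _*_; _≤_)
open import Data.Fin using (Fin; zero; suc)
open import Data.Fin.Subset using (Subset; ∣_∣)
open import Data.Vec using (lookup)
open import Data.Bool using (Bool; true; false; not)
open import Data.Product using (Σ; ∃; _×_; _,_; proj₁; proj₂)
open import Data.Sum using (_⊎_; inj₁; inj₂)
open import Data.Unit using (⊤)
open import Function using (_∘_)
open import Function.Bundles using (_↔_; Inverse; _⇔_)
open import Relation.Binary.PropositionalEquality using (_≡_; _≢_)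
open import Relation.Nullary using (¬_)

-- General (multi)graphs: a vertex type, an edge type, and the ends of
-- each edge (an unordered pair, stored as an ordered pair).

record Graph : Set₁ where
  field
    V    : Set
    E    : Set
    ends : E → V × V

open Graph public

Joins : (G : Graph) → E G → V G → V G → Set
Joins G e u w = ends G e ≡ (u , w) ⊎ ends G e ≡ (w , u)

record SimpleGraph (n m : ℕ) : Set where
  field
    edge       : Fin m → Fin n × Fin n
    noLoop     : ∀ e → proj₁ (edge e) ≢ proj₂ (edge e)
    noParallel : ∀ e e' →
                 (edge e ≡ edge e' ⊎ edge e ≡ (proj₂ (edge e') , proj₁ (edge e'))) →
                 e ≡ e'

open SimpleGraph public

toGraph : ∀ {n m} → SimpleGraph n m → Graph
toGraph {n} {m} G = record { V = Fin n ; E = Fin m ; ends = edge G }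

data Reach (G : Graph) (A : V G → Set) : V G → V G → Set where
  here : ∀ {u} → A u → Reach G A u u
  step : ∀ {u v w} (e : E G) → A u → Joins G e u v → Reach G A v w → Reach G A u w

Connected : Graph → Set
Connected G = ∀ u w → Reach G (λ _ → ⊤) u w

IsCutVertex : (G : Graph) → V G → Set
IsCutVertex G v = Σ (V G) λ u → Σ (V G) λ w →
  u ≢ v × w ≢ v × ¬ Reach G (λ x → x ≢ v) u w

NoCutVertex : Graph → Set
NoCutVertex G = ∀ v → ¬ IsCutVertex G v

cycSuc : ∀ {k} → Fin (suc k) → Fin (suc k)
cycSuc {zero}  zero    = zero
cycSuc {suc k} zero    = suc zero
cycSuc {suc k} (suc i) with cycSuc {k} i
... | zero  = zero
... | suc j = suc (suc j)

-- A cycle of length (suc k): distinct vertices v₀ … v_k and distinct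
-- edges e₀ … e_k, where e_i joins v_i and v_{i+1 mod (k+1)}.
record Cycle (G : Graph) (k : ℕ) : Set where
  field
    vs    : Fin (suc k) → V G
    es    : Fin (suc k) → E G
    vsInj : ∀ i j → vs i ≡ vs j → i ≡ j
    esInj : ∀ i j → es i ≡ es j → i ≡ j
    joins : ∀ i → Joins G (es i) (vs i) (vs (cycSuc i))

NoOddCycle : Graph → Set
NoOddCycle G = ∀ j → ¬ Cycle G (2 * j)

-- Subdividing every edge e with S e ≡ true (each such edge once):
-- e = uw is replaced by a new vertex (e) and edges u-(e), (e)-w.

Subdivide : (G : Graph) → (E G → Bool) → Graph
Subdivide G S = record { V = V' ; E = E' ; ends = ends' }
  where
  V' : Set
  V' = V G ⊎ Σ (E G) (λ e → S e ≡ true)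
  E' : Set
  E' = Σ (E G) (λ e → S e ≡ false) ⊎ (Σ (E G) (λ e → S e ≡ true) × Bool)
  ends' : E' → V' × V'
  ends' (inj₁ (e , _)) = inj₁ (proj₁ (ends G e)) , inj₁ (proj₂ (ends G e))
  ends' (inj₂ (x , false)) = inj₁ (proj₁ (ends G (proj₁ x))) , inj₂ x
  ends' (inj₂ (x , true))  = inj₂ x , inj₁ (proj₂ (ends G (proj₁ x)))

SubdivideAlong : ∀ {n m} → SimpleGraph n m → Subset m → Graph
SubdivideAlong G S = Subdivide (toGraph G) (λ e → lookup S e)

Dart : ℕ → Set
Dart m = Fin m × Bool

tail : ∀ {n m} → SimpleGraph n m → Dart m → Fin n
tail G (e , false) = proj₁ (edge G e)
tail G (e , true)  = proj₂ (edge G e)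

flipD : ∀ {m} → Dart m → Dart m
flipD (e , b) = (e , not b)

iter : ∀ {A : Set} → (A → A) → ℕ → A → A
iter f zero    x = x
iter f (suc k) x = f (iter f k x)

SameOrbit : ∀ {A : Set} → (A → A) → A → A → Set
SameOrbit f x y = ∃ λ k → iter f k x ≡ y

-- A rotation system: a permutation σ of the darts whose orbits are
-- exactly the sets of darts with a common tail (cyclic order around
-- each vertex).
record RotationSystem {n m} (G : SimpleGraph n m) : Set where
  field
    σ      : Dart m ↔ Dart m
    σOrbit : ∀ d d' → (tail G d ≡ tail G d' ⇔ SameOrbit (Inverse.to σ) d d')

faceMap : ∀ {n m} {G : SimpleGraph n m} → RotationSystem G → Dart m → Dart m
faceMap ρ = Inverse.to (RotationSystem.σ ρ) ∘ flipD

-- The embedding has exactly F faces (= orbits of φ): there is a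
-- surjective labelling of darts by Fin F identifying exactly the φ-orbits.
HasFaceCount : ∀ {n m} {G : SimpleGraph n m} → RotationSystem G → ℕ → Set
HasFaceCount {n} {m} ρ F = Σ (Dart m → Fin F) λ face →
  (∀ f → ∃ λ d → face d ≡ f) ×
  (∀ d d' → (face d ≡ face d' ⇔ SameOrbit (faceMap ρ) d d'))

-- G (connected) has a plane embedding with exactly C faces:
-- either G has no edges (one face, by convention), or G has a rotation
-- system with C faces and of genus 0, i.e. satisfying Euler's formula
-- n - m + C = 2.
PlaneWithFaces : ∀ {n m} → SimpleGraph n m → ℕ → Set
PlaneWithFaces {n} {m} G C =
  (m ≡ 0 × C ≡ 1) ⊎
  Σ (RotationSystem G) λ ρ → HasFaceCount ρ C × n + C ≡ m + 2

-- Properly 2-colour a spanning tree. Its n − 1 edges are bichromatic, so at most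
-- m − (n − 1) = C − 1 edges are monochromatic, by Euler's formula n − m + C = 2.
-- Subdividing exactly the monochromatic edges, and giving each new vertex the
-- colour opposite to the (common) colour of its neighbours, yields a properly
-- 2-coloured graph, and a properly 2-coloured graph has no odd cycle.
module Submission where

open import Defs
open import Data.Bool using (Bool; true; false; not)
import Data.Bool as Bool
open import Data.Bool.Properties using (not-involutive; not-¬)
open import Data.Empty using (⊥-elim)
open import Data.Fin using (Fin; zero; suc; toℕ; inject₁; fromℕ)
open import Data.Fin.Properties using (toℕ-fromℕ)
open import Data.Fin.Subset
  using (Subset; ∣_∣; _∈_; _∉_; _⊆_; _⊂_; _∪_; ⁅_⁆; ∁; ⊤; inside; outside)
  renaming (⊥ to ∅)
open import Data.Fin.Subset.Properties
  using ( ∣p∣≤n; ∣p∣≤∣x∷p∣; ∣⊤∣≡n; ∣⁅x⁆∣≡1; ∣∁p∣≡n∸∣p∣; p⊆q⇒∣p∣≤∣q∣; p⊂q⇒∣p∣<∣q∣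
        ; p⊆p∪q; x∈p∪q⁺; x∈p∪q⁻; x∈⁅x⁆; x∈⁅y⁆⇒x≡y; ∉⊥
        ; x∉p⇒x∈∁p; x∈∁p⇒x∉p; x∉∁p⇒x∈p; _∈?_; nonempty?)
open import Data.Nat using (ℕ; zero; suc; _+_; _*_; _∸_; _≤_; _<_; z≤n; s≤s)
open import Data.Nat.Properties
  using ( ≤-trans; ≤-reflexive; <⇒≤; <⇒≱; n≤1+n; n<1+n; +-comm; +-suc; *-suc
        ; +-monoʳ-≤; +-monoˡ-≤; +-cancelˡ-<; m≤n+m; m≤n+m∸n; m≤o∸n⇒m+n≤o; module ≤-Reasoning)
open import Data.Product using (Σ; ∃; _×_; _,_; proj₁; proj₂; swap)
import Data.Product as Product
open import Data.Sum using (_⊎_; inj₁; inj₂; [_,_])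
open import Data.Vec using ([]; _∷_; lookup; tabulate)
open import Data.Vec.Properties using (lookup∘tabulate; []=⇒lookup)
open import Data.Vec.Functional using (updateAt)
open import Data.Vec.Functional.Properties using (updateAt-updates; updateAt-minimal)
open import Function using (_∘_)
open import Relation.Binary.PropositionalEquality hiding ([_])
open import Relation.Nullary using (¬_; yes; no; does)
open import Relation.Unary using (Decidable)

cycSuc-inject₁ : ∀ {k} (i : Fin k) → cycSuc (inject₁ i) ≡ suc i
cycSuc-inject₁ {suc k} zero    = refl
cycSuc-inject₁ {suc k} (suc i) rewrite cycSuc-inject₁ i = refl

cycSuc-fromℕ : ∀ k → cycSuc (fromℕ k) ≡ zero
cycSuc-fromℕ zero    = refl
cycSuc-fromℕ (suc k) rewrite cycSuc-fromℕ k = refl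

iter-comm : ∀ {A : Set} (f : A → A) t x → iter f t (f x) ≡ f (iter f t x)
iter-comm f zero    x = refl
iter-comm f (suc t) x = cong f (iter-comm f t x)

iter-not-even : ∀ j b → iter not (2 * j) b ≡ b
iter-not-even zero    b = refl
iter-not-even (suc j) b = begin
  iter not (2 * suc j) b          ≡⟨ cong (λ t → iter not t b) (*-suc 2 j) ⟩
  not (not (iter not (2 * j) b))  ≡⟨ not-involutive _ ⟩
  iter not (2 * j) b              ≡⟨ iter-not-even j b ⟩
  b                               ∎
  where open ≡-Reasoning

alternating : ∀ {k} (g : Fin (suc k) → Bool) →
  (∀ (i : Fin k) → g (suc i) ≡ not (g (inject₁ i))) →
  ∀ i → g i ≡ iter not (toℕ i) (g zero)
alternating         g next zero    = refl
alternating {suc k} g next (suc i) = begin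
  g (suc i)                        ≡⟨ alternating (g ∘ suc) (next ∘ suc) i ⟩
  iter not (toℕ i) (g (suc zero))  ≡⟨ cong (iter not (toℕ i)) (next zero) ⟩
  iter not (toℕ i) (not (g zero))  ≡⟨ iter-comm not (toℕ i) (g zero) ⟩
  not (iter not (toℕ i) (g zero))  ∎
  where open ≡-Reasoning

no-odd-alternation : ∀ j (g : Fin (suc (2 * j)) → Bool) →
  ¬ (∀ i → g (cycSuc i) ≡ not (g i))
no-odd-alternation j g alt = not-¬ refl wrap-around
  where
  open ≡-Reasoning
  k : ℕ
  k = 2 * j
  next : ∀ (i : Fin k) → g (suc i) ≡ not (g (inject₁ i))
  next i = subst (λ v → g v ≡ not (g (inject₁ i))) (cycSuc-inject₁ i) (alt (inject₁ i))
  wrap-around : g zero ≡ not (g zero)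
  wrap-around = begin
    g zero                                  ≡⟨ cong g (sym (cycSuc-fromℕ k)) ⟩
    g (cycSuc (fromℕ k))                    ≡⟨ alt (fromℕ k) ⟩
    not (g (fromℕ k))                       ≡⟨ cong not (alternating g next (fromℕ k)) ⟩
    not (iter not (toℕ (fromℕ k)) (g zero))
      ≡⟨ cong (λ t → not (iter not t (g zero))) (toℕ-fromℕ k) ⟩
    not (iter not k (g zero))               ≡⟨ cong not (iter-not-even j (g zero)) ⟩
    not (g zero)                            ∎

IsProperColouring : (H : Graph) → (V H → Bool) → Set
IsProperColouring H col = ∀ e → col (proj₂ (ends H e)) ≡ not (col (proj₁ (ends H e)))

joins-proper : ∀ {H col e u w} → IsProperColouring H col → Joins H e u w → col w ≡ not (col u)
joins-proper {H} {col} {e} proper = [ along , swap-not ∘ along ]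
  where
  along : ∀ {p} → ends H e ≡ p → col (proj₂ p) ≡ not (col (proj₁ p))
  along eq = subst (λ p → col (proj₂ p) ≡ not (col (proj₁ p))) eq (proper e)
  swap-not : ∀ {a b} → b ≡ not a → a ≡ not b
  swap-not {a} b≡¬a = trans (sym (not-involutive a)) (cong not (sym b≡¬a))

properColouring⇒noOddCycle : ∀ H col → IsProperColouring H col → NoOddCycle H
properColouring⇒noOddCycle H col proper j cycle =
  no-odd-alternation j (col ∘ vs) (λ i → joins-proper {H} {col} proper (joins i))
  where open Cycle cycle

isMonochromatic : (G : Graph) → (V G → Bool) → E G → Bool
isMonochromatic G c e = does (c (proj₁ (ends G e)) Bool.≟ c (proj₂ (ends G e)))

sameColour-true : ∀ a b → does (a Bool.≟ b) ≡ true → a ≡ b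
sameColour-true false false _ = refl
sameColour-true true  true  _ = refl

sameColour-false : ∀ a b → does (a Bool.≟ b) ≡ false → b ≡ not a
sameColour-false false true  _ = refl
sameColour-false true  false _ = refl

subdivisionColouring : (G : Graph) (S : E G → Bool) → (V G → Bool) → V (Subdivide G S) → Bool
subdivisionColouring G S c (inj₁ v)       = c v
subdivisionColouring G S c (inj₂ (e , _)) = not (c (proj₁ (ends G e)))

subdivide-monochromatic-proper : (G : Graph) (c : V G → Bool) (S : E G → Bool) →
  (∀ e → S e ≡ isMonochromatic G c e) →
  IsProperColouring (Subdivide G S) (subdivisionColouring G S c)
subdivide-monochromatic-proper G c S S≡ (inj₁ (e , unsplit)) =
  sameColour-false _ _ (trans (sym (S≡ e)) unsplit)
subdivide-monochromatic-proper G c S S≡ (inj₂ ((e , split) , false)) = refl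
subdivide-monochromatic-proper G c S S≡ (inj₂ ((e , split) , true))  =
  trans (sym (sameColour-true _ _ (trans (sym (S≡ e)) split))) (sym (not-involutive _))

∣p∪q∣≤∣p∣+∣q∣ : ∀ {n} (p q : Subset n) → ∣ p ∪ q ∣ ≤ ∣ p ∣ + ∣ q ∣
∣p∪q∣≤∣p∣+∣q∣ []            []            = z≤n
∣p∪q∣≤∣p∣+∣q∣ (inside  ∷ p) (t       ∷ q) =
  s≤s (≤-trans (∣p∪q∣≤∣p∣+∣q∣ p q) (+-monoʳ-≤ ∣ p ∣ (∣p∣≤∣x∷p∣ t q)))
∣p∪q∣≤∣p∣+∣q∣ (outside ∷ p) (inside  ∷ q) =
  ≤-trans (s≤s (∣p∪q∣≤∣p∣+∣q∣ p q)) (≤-reflexive (sym (+-suc ∣ p ∣ ∣ q ∣)))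
∣p∪q∣≤∣p∣+∣q∣ (outside ∷ p) (outside ∷ q) = ∣p∪q∣≤∣p∣+∣q∣ p q

∣p∣<n⇒∃∉ : ∀ {n} (p : Subset n) → ∣ p ∣ < n → ∃ λ x → x ∉ p
∣p∣<n⇒∃∉ {n} p ∣p∣<n with nonempty? (∁ p)
... | yes (x , x∈∁p) = x , x∈∁p⇒x∉p x∈∁p
... | no  ∁p-empty   = ⊥-elim (<⇒≱ ∣p∣<n (subst (_≤ ∣ p ∣) (∣⊤∣≡n n) (p⊆q⇒∣p∣≤∣q∣ ⊤⊆p)))
  where
  ⊤⊆p : ⊤ ⊆ p
  ⊤⊆p {x} _ = x∉∁p⇒x∈p (λ x∈∁p → ∁p-empty (x , x∈∁p))

walk-exits : (G : Graph) {A : V G → Set} (P : V G → Set) → Decidable P →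
  ∀ {u w} → Reach G A u w → P u → ¬ P w →
  Σ (E G) λ e → Σ (V G) λ x → Σ (V G) λ y → Joins G e x y × P x × ¬ P y
walk-exits G P P? (here _)                 Pu ¬Pw = ⊥-elim (¬Pw Pu)
walk-exits G P P? (step {v = v} e _ uv vw) Pu ¬Pw with P? v
... | yes Pv = walk-exits G P P? vw Pv ¬Pw
... | no ¬Pv = e , _ , v , uv , Pu , ¬Pv

module _ {n m} (G : SimpleGraph n m) where

  src dst : Fin m → Fin n
  src e = proj₁ (edge G e)
  dst e = proj₂ (edge G e)

  joins-elim : ∀ {e x y} (R : Fin n → Fin n → Set) → (∀ {a b} → R a b → R b a) →
    Joins (toGraph G) e x y → R x y → R (src e) (dst e)
  joins-elim R R-sym (inj₁ eq) r = subst (λ p → R (proj₁ p) (proj₂ p)) (sym eq) r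
  joins-elim R R-sym (inj₂ eq) r = subst (λ p → R (proj₁ p) (proj₂ p)) (sym eq) (R-sym r)

  joins-endpoint : ∀ {e x y} → Joins (toGraph G) e x y → y ≡ src e ⊎ y ≡ dst e
  joins-endpoint (inj₁ eq) = inj₂ (cong proj₂ (sym eq))
  joins-endpoint (inj₂ eq) = inj₁ (cong proj₁ (sym eq))

  monochromatic : (Fin n → Bool) → Subset m
  monochromatic c = tabulate (isMonochromatic (toGraph G) c)

  Bichromatic : (Fin n → Bool) → Fin m → Set
  Bichromatic c e = c (src e) ≢ c (dst e)

  bichromatic⇒∉monochromatic : ∀ {c e} → Bichromatic c e → e ∉ monochromatic c
  bichromatic⇒∉monochromatic {c} {e} bichromatic e∈ =
    bichromatic (sameColour-true _ _ (trans (sym (lookup∘tabulate _ e)) ([]=⇒lookup e∈)))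

  ∣bichromatic∣+∣monochromatic∣≤m : ∀ c (T : Subset m) → (∀ {e} → e ∈ T → Bichromatic c e) →
    ∣ T ∣ + ∣ monochromatic c ∣ ≤ m
  ∣bichromatic∣+∣monochromatic∣≤m c T T-bichromatic =
    m≤o∸n⇒m+n≤o ∣ T ∣ (∣p∣≤n (monochromatic c))
      (subst (∣ T ∣ ≤_) (∣∁p∣≡n∸∣p∣ (monochromatic c)) (p⊆q⇒∣p∣≤∣q∣ T⊆bichromatic))
    where
    T⊆bichromatic : T ⊆ ∁ (monochromatic c)
    T⊆bichromatic e∈T = x∉p⇒x∈∁p (bichromatic⇒∉monochromatic {c} (T-bichromatic e∈T))

  record ColouredTree (root : Fin n) (k : ℕ) : Set where
    field
      vertices          : Subset n
      colour            : Fin n → Bool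
      edges             : Subset m
      root∈             : root ∈ vertices
      ∣vertices∣≤        : ∣ vertices ∣ ≤ suc k
      k≤∣edges∣          : k ≤ ∣ edges ∣
      edges⊆            : ∀ {e} → e ∈ edges → src e ∈ vertices × dst e ∈ vertices
      edges-bichromatic : ∀ {e} → e ∈ edges → Bichromatic colour e

  singleton : ∀ root → ColouredTree root 0
  singleton root = record
    { vertices          = ⁅ root ⁆
    ; colour            = λ _ → false
    ; edges             = ∅
    ; root∈             = x∈⁅x⁆ root
    ; ∣vertices∣≤        = ≤-reflexive (∣⁅x⁆∣≡1 root)
    ; k≤∣edges∣          = z≤n
    ; edges⊆            = ⊥-elim ∘ ∉⊥
    ; edges-bichromatic = ⊥-elim ∘ ∉⊥
    }

  attach : ∀ {root k e x y} (t : ColouredTree root k) → Joins (toGraph G) e x y →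
    x ∈ ColouredTree.vertices t → y ∉ ColouredTree.vertices t → ColouredTree root (suc k)
  attach {k = k} {e} {x} {y} t xy x∈P y∉P = record
    { vertices          = P′
    ; colour            = c′
    ; edges             = T ∪ ⁅ e ⁆
    ; root∈             = P⊆P′ root∈
    ; ∣vertices∣≤        = ∣P′∣≤
    ; k≤∣edges∣          = ≤-trans (s≤s k≤∣edges∣) (p⊂q⇒∣p∣<∣q∣ T⊂T′)
    ; edges⊆            = T∪⁅e⁆-elim (Product.map P⊆P′ P⊆P′ ∘ edges⊆)
                            (joins-elim (λ a b → a ∈ P′ × b ∈ P′) swap xy (P⊆P′ x∈P , y∈P′))
    ; edges-bichromatic = T∪⁅e⁆-elim old-bichromatic
                            (joins-elim (λ a b → c′ a ≢ c′ b) ≢-sym xy new-bichromatic)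
    }
    where
    open ColouredTree t renaming (vertices to P; colour to c; edges to T)

    P′ : Subset n
    P′ = P ∪ ⁅ y ⁆

    c′ : Fin n → Bool
    c′ = updateAt c y (λ _ → not (c x))

    T∪⁅e⁆-elim : ∀ {A : Fin m → Set} → (∀ {f} → f ∈ T → A f) → A e → ∀ {f} → f ∈ T ∪ ⁅ e ⁆ → A f
    T∪⁅e⁆-elim {A} old new f∈ with x∈p∪q⁻ T ⁅ e ⁆ f∈
    ... | inj₁ f∈T = old f∈T
    ... | inj₂ f∈e = subst A (sym (x∈⁅y⁆⇒x≡y e f∈e)) new

    P⊆P′ : ∀ {u} → u ∈ P → u ∈ P′
    P⊆P′ = x∈p∪q⁺ ∘ inj₁
    y∈P′ : y ∈ P′
    y∈P′ = x∈p∪q⁺ (inj₂ (x∈⁅x⁆ y))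

    ∣P′∣≤ : ∣ P′ ∣ ≤ suc (suc k)
    ∣P′∣≤ = begin
      ∣ P′ ∣            ≤⟨ ∣p∪q∣≤∣p∣+∣q∣ P ⁅ y ⁆ ⟩
      ∣ P ∣ + ∣ ⁅ y ⁆ ∣ ≡⟨ cong (∣ P ∣ +_) (∣⁅x⁆∣≡1 y) ⟩
      ∣ P ∣ + 1         ≡⟨ +-comm ∣ P ∣ 1 ⟩
      suc ∣ P ∣         ≤⟨ s≤s ∣vertices∣≤ ⟩
      suc (suc k)       ∎
      where open ≤-Reasoning

    e∉T : e ∉ T
    e∉T e∈T with joins-endpoint xy | edges⊆ e∈T
    ... | inj₁ y≡src | src∈P , _ = y∉P (subst (_∈ P) (sym y≡src) src∈P)
    ... | inj₂ y≡dst | _ , dst∈P = y∉P (subst (_∈ P) (sym y≡dst) dst∈P)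

    T⊂T′ : T ⊂ T ∪ ⁅ e ⁆
    T⊂T′ = p⊆p∪q ⁅ e ⁆ , e , x∈p∪q⁺ (inj₂ (x∈⁅x⁆ e)) , e∉T

    c′-old : ∀ {u} → u ∈ P → c′ u ≡ c u
    c′-old {u} u∈P = updateAt-minimal u y c (λ where refl → y∉P u∈P)

    old-bichromatic : ∀ {f} → f ∈ T → Bichromatic c′ f
    old-bichromatic f∈T same with edges⊆ f∈T
    ... | src∈P , dst∈P =
      edges-bichromatic f∈T (trans (sym (c′-old src∈P)) (trans same (c′-old dst∈P)))

    new-bichromatic : c′ x ≢ c′ y
    new-bichromatic same = not-¬ refl (trans (sym (c′-old x∈P)) (trans same (updateAt-updates y c)))

  module Growth (connected : Connected (toGraph G)) (root : Fin n) where
    open ColouredTree using (vertices; root∈; ∣vertices∣≤)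

    extend : ∀ {k} (t : ColouredTree root k) → ∣ vertices t ∣ < n →
      ColouredTree root (suc k)
    extend t ∣P∣<n
      with v , v∉P ← ∣p∣<n⇒∃∉ (vertices t) ∣P∣<n
      with _ , _ , _ , xy , x∈P , y∉P ←
             walk-exits (toGraph G) (_∈ vertices t) (_∈? vertices t) (connected root v) (root∈ t) v∉P
      = attach t xy x∈P y∉P

    grow : ∀ k → k < n → ColouredTree root k
    grow zero    _   = singleton root
    grow (suc k) k<n = extend t (≤-trans (s≤s (∣vertices∣≤ t)) k<n)
      where
      t : ColouredTree root k
      t = grow k (≤-trans (n≤1+n (suc k)) k<n)

few-monochromatic : ∀ {n m} (G : SimpleGraph n m) → Connected (toGraph G) →
  Σ (Fin n → Bool) λ c → n ∸ 1 + ∣ monochromatic G c ∣ ≤ m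
few-monochromatic {zero}   G connected = (λ ()) , ∣p∣≤n (monochromatic G (λ ()))
few-monochromatic {suc n′} G connected =
  colour ,
  ≤-trans (+-monoˡ-≤ _ k≤∣edges∣) (∣bichromatic∣+∣monochromatic∣≤m G colour edges edges-bichromatic)
  where open ColouredTree (Growth.grow G connected zero n′ (n<1+n n′))

euler-bound : ∀ {n m C s} → n + C ≡ m + 2 → n ∸ 1 + s ≤ m → s ≤ C
euler-bound {n} {m} {C} {s} euler bound = <⇒≤ (+-cancelˡ-< n s C (begin-strict
  n + s             ≤⟨ +-monoˡ-≤ s (m≤n+m∸n n 1) ⟩
  suc (n ∸ 1 + s)   ≤⟨ s≤s bound ⟩
  suc m             <⟨ n<1+n (suc m) ⟩
  suc (suc m)       ≡⟨ sym (trans euler (+-comm m 2)) ⟩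
  n + C             ∎))
  where open ≤-Reasoning

planeWithFaces-bound : ∀ {n m} (G : SimpleGraph n m) {C s} → PlaneWithFaces G C →
  n ∸ 1 + s ≤ m → s ≤ C
planeWithFaces-bound {n} G {s = s} (inj₁ (refl , _)) bound =
  ≤-trans (≤-trans (m≤n+m s (n ∸ 1)) bound) z≤n
planeWithFaces-bound G (inj₂ (_ , _ , euler)) bound = euler-bound euler bound

mainTheorem2 : ∀ {n m} (G : SimpleGraph n m) (C : ℕ) →
    Connected (toGraph G) → NoCutVertex (toGraph G) → PlaneWithFaces G C →
    Σ (Subset m) λ S → ∣ S ∣ ≤ C × NoOddCycle (SubdivideAlong G S)
mainTheorem2 {n} {m} G C connected _ plane =
  S , planeWithFaces-bound G plane bound ,
  properColouring⇒noOddCycle (SubdivideAlong G S) (subdivisionColouring (toGraph G) (lookup S) c)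
    (subdivide-monochromatic-proper (toGraph G) c (lookup S) (lookup∘tabulate _))
  where
  c : Fin n → Bool
  c = proj₁ (few-monochromatic G connected)
  S : Subset m
  S = monochromatic G c
  bound : n ∸ 1 + ∣ S ∣ ≤ m
  bound = proj₂ (few-monochromatic G connected)
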